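{- (1) For every integer $n \geq 5$, \[ \max N(0,2;n) = \begin{cases} 3^{n/3} & n \equiv 0 \pmod 3,\\ 11 \cdot 3^{(n-7)/3} & n \equiv 1 \pmod 3,\\ 5 \cdot 3^{(n-5)/3} & n \equiv 2 \pmod 3,\end{cases} \] and this maximum is attained at a unique partition of $n$, namely $(3,3,\dots,3)$ if $n\equiv 0 \pmod 3$, $(3,\dots,3,7)$ if $n \equiv 1 \pmod 3$, and $(3,\dots,3,5)$ if $n \equiv 2 \pmod 3$. (2) For every integer $n \geq 8$, \[ \max N(1,2;n) = \begin{cases} 2^{n/2} & n \equiv 0 \pmod 2,\\ 12\cdot 2^{(n-9)/2} & n \equiv 1 \pmod 2,\end{cases} \] and the partitions of $n$ attaining this maximum are exactly those obtained from $(2,2,\dots,2)$ (if $n$ is even) or from $(2,\dots,2,9)$ (if $n$ is odd) by performing any number of the substitutions replacing two parts $2,2$ by a single part $4$, or replacing three parts $2,2,2$ by a single part $6$.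
   Context: A partition of $n$ is a finite nondecreasing list of positive integers $\lambda = (\lambda_1 \le \dots \le \lambda_k)$ summing to $n$; its rank is $\lambda_k - k$. $N(r,2;m)$ denotes the number of partitions of $m$ whose rank is congruent to $r$ modulo $2$. For a partition $\lambda = (\lambda_1,\dots,\lambda_k)$ define $N(r,2;\lambda) := \prod_{j=1}^k N(r,2;\lambda_j)$. Letting $P(n)$ be the set of all partitions of $n$, define $\max N(r,2;n) := \max\{N(r,2;\lambda) : \lambda \in P(n)\}$. -}

module Defs where

open import Data.Nat as ℕ using (ℕ; zero; suc; _≤_; _<_; _∸_; _≤?_; _≟_)
open import Data.Integer as ℤ using (ℤ; +_)
import Data.Integer.DivMod as ℤDM
open import Data.Nat.ListAction using (sum; product)
open import Data.List using (List; []; _∷_; [_]; length; map; filter; concatMap; upTo; last)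
open import Data.List.Relation.Unary.All using (All)
open import Data.List.Relation.Unary.Linked using (Linked)
open import Data.List.Relation.Binary.Permutation.Propositional using (_↭_)
open import Data.Maybe using (fromMaybe)
open import Data.Product using (_×_; ∃)
open import Data.Sum using (_⊎_)
open import Relation.Binary.PropositionalEquality using (_≡_)
open import Relation.Binary.Construct.Closure.ReflexiveTransitive using (Star)

IsPartition : ℕ → List ℕ → Set
IsPartition n p = Linked _≤_ p × All (0 <_) p × sum p ≡ n

-- Largest part (the last entry of a nondecreasing list); 0 for the empty list.
largest : List ℕ → ℕ
largest p = fromMaybe 0 (last p)

rank : List ℕ → ℤ
rank p = (+ largest p) ℤ.- (+ length p)

-- go fuel k m : all nondecreasing lists of positive integers, every part ≥ k,
-- summing to m (complete as long as fuel ≥ m).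
go : ℕ → ℕ → ℕ → List (List ℕ)
go _          k zero    = [ [] ]
go zero       k (suc m) = []
go (suc fuel) k (suc m) =
  concatMap (λ j → map (j ∷_) (go fuel j (suc m ∸ j)))
            (filter (k ≤?_) (map suc (upTo (suc m))))

partitions : ℕ → List (List ℕ)
partitions m = go m 1 m

N : ℕ → ℕ → ℕ
N r m = length (filter (λ p → ℤDM._%_ (rank p) (+ 2) ≟ r) (partitions m))

Nλ : ℕ → List ℕ → ℕ
Nλ r p = product (map (N r) p)

MaxNIs : ℕ → ℕ → ℕ → Set
MaxNIs r n v = (∃ λ p → IsPartition n p × Nλ r p ≡ v)
             × (∀ p → IsPartition n p → Nλ r p ≤ v)

-- One substitution (on multisets of parts): replace parts 2,2 by 4, or 2,2,2 by 6.
Step : List ℕ → List ℕ → Set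
Step p q = (∃ λ ρ → p ↭ (2 ∷ 2 ∷ ρ) × q ↭ (4 ∷ ρ))
         ⊎ (∃ λ ρ → p ↭ (2 ∷ 2 ∷ 2 ∷ ρ) × q ↭ (6 ∷ ρ))

Obtainable : List ℕ → List ℕ → Set
Obtainable = Star Step

{-# OPTIONS --safe #-}
module Submission where

-- M₀ and M₁ (the claimed maxima) are supermultiplicative, so Nλ r p ≤ M_r (sum p) as soon as
-- N(r,2;m) ≤ M_r m for every single part m. This is checked by evaluation for m < 31; beyond,
-- N(r,2;m) ≤ p(m) ≤ 21 (5/4)^m, which M_r outgrows since it grows like 3^(m/3) resp. 2^(m/2).
-- The bound on p(m) is a weighted induction over partitions of m with all parts ≥ k.
-- Equality forces every part to be one of finitely many sizes m with N(r,2;m) = M_r m, and every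
-- split M_r a · M_r b = M_r (a + b) along the sorted partition to be tight. For r = 0 this leaves
-- only 3…3, 3…35 and 3…37, which are determined by their size; for r = 1 it leaves partitions
-- into parts 2, 4, 6 with at most one extra part 9, all obtainable from 2…2 resp. 2…29.

open import Defs
open import Data.Bool using (true)
open import Data.List using (List; []; _∷_; [_]; length; map; filter; concatMap; upTo; applyUpTo; replicate; _++_)
open import Data.List.Properties using (filter-accept; filter-reject; filter-all; length-++; length-map; length-filter; map-upTo; map-++; ++-identityʳ)
open import Data.List.Relation.Binary.Permutation.Propositional using (_↭_; ↭-refl; ↭-prep; ↭-trans)
open import Data.List.Relation.Binary.Permutation.Propositional.Properties using (shifts; map⁺)
open import Data.List.Relation.Unary.All as All using (All; []; _∷_)
import Data.List.Relation.Unary.All.Properties as All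
open import Data.List.Relation.Unary.Linked as Linked using (Linked; []; [-]; _∷_)
open import Data.List.Relation.Unary.Linked.Properties using (Linked⇒All)
open import Data.Nat
open import Data.Nat.DivMod using (_%_; _/_; m≡m%n+[m/n]*n; m/n*n≡m; [m+kn]%n≡m%n)
open import Data.Nat.Divisibility using (divides)
open import Data.Nat.Induction using (<-rec)
open import Data.Nat.ListAction using (sum; product)
open import Data.Nat.ListAction.Properties using (sum-++; product-++; sum-↭; product-↭)
open import Data.Nat.Properties
open import Algebra.Properties.CommutativeSemigroup *-commutativeSemigroup using (x∙yz≈y∙xz)
open import Data.Nat.Tactic.RingSolver using (solve-∀)
open import Data.Product using (Σ; _×_; _,_; proj₁; proj₂)
open import Data.Sum using (_⊎_; inj₁; inj₂)
open import Data.Unit using (tt)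
open import Function using (case_of_)
open import Function.Bundles using (_⇔_; mk⇔)
open import Relation.Binary.Construct.Closure.ReflexiveTransitive using (ε; _◅_; gmap; fold)
open import Relation.Binary.PropositionalEquality hiding ([_])
open import Relation.Nullary using (Dec; does; yes; no; contradiction)
open import Relation.Nullary.Decidable using (_×-dec_; _⊎-dec_; _→-dec_)
open import Relation.Unary using (Decidable)

stepwise-induction : ∀ {d n₀} (P : ℕ → Set) → 0 < d →
                     (∀ {n} → n < n₀ + d → P n) →
                     (∀ {n} → n₀ ≤ n → P n → P (d + n)) →
                     ∀ n → P n
stepwise-induction {d} {n₀} P d>0 window step = <-rec P induct
  where
  induct : ∀ n → (∀ {m} → m < n → P m) → P n
  induct n rec with n <? n₀ + d
  ... | yes n<n₀+d = window n<n₀+d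
  ... | no  n≮n₀+d = subst P (m+[n∸m]≡n d≤n) (step (m+n≤o⇒m≤o∸n n₀ n₀+d≤n) (rec (∸-monoʳ-< d>0 d≤n)))
    where
    n₀+d≤n = ≮⇒≥ n≮n₀+d
    d≤n = ≤-trans (m≤n+m d n₀) n₀+d≤n

-- The hypothesis is discharged by refl, which Agda evaluates much faster than `True a?`.
by-evaluation : ∀ {A : Set} (a? : Dec A) → does a? ≡ true → A
by-evaluation (yes a) _ = a
by-evaluation (no _)  ()

*-≤-tight : ∀ {a A b B C} → a ≤ A → b ≤ B → A * B ≤ C → a * b ≡ C → 0 < C →
            a ≡ A × b ≡ B × A * B ≡ C
*-≤-tight {a} {A} {b} {B} {C} a≤A b≤B AB≤C ab≡C C>0 =
  *-cancelʳ-≡ a A b {{b≢0}} ab≡Ab , *-cancelˡ-≡ b B A {{A≢0}} Ab≡AB , AB≡C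
  where
  ab≤Ab = *-monoˡ-≤ b a≤A
  Ab≤AB = *-monoʳ-≤ A b≤B
  C≤ab = ≤-reflexive (sym ab≡C)
  AB≡C = ≤-antisym AB≤C (≤-trans C≤ab (≤-trans ab≤Ab Ab≤AB))
  Ab≡AB = ≤-antisym Ab≤AB (≤-trans AB≤C (≤-trans C≤ab ab≤Ab))
  ab≡Ab = ≤-antisym ab≤Ab (≤-trans Ab≤AB (≤-trans AB≤C C≤ab))
  b≢0 = m*n≢0⇒n≢0 a {{>-nonZero (subst (0 <_) (sym ab≡C) C>0)}}
  A≢0 = m*n≢0⇒m≢0 A {{>-nonZero (<-≤-trans C>0 (≤-reflexive (sym AB≡C)))}}

residue-decomposition : ∀ {n} t d .{{_ : NonZero d}} → t ≤ n → n % d ≡ t % d → n ≡ t + (n ∸ t) / d * d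
residue-decomposition {n} t d t≤n n≡t = begin
  n                    ≡⟨ m+[n∸m]≡n t≤n ⟨
  t + (n ∸ t)          ≡⟨ cong (t +_) (m/n*n≡m (divides (n / d ∸ t / d) n∸t≡)) ⟨
  t + (n ∸ t) / d * d  ∎
  where
  open ≡-Reasoning
  n∸t≡ : n ∸ t ≡ (n / d ∸ t / d) * d
  n∸t≡ = begin
    n ∸ t                                      ≡⟨ cong₂ _∸_ (m≡m%n+[m/n]*n n d) (m≡m%n+[m/n]*n t d) ⟩
    (n % d + n / d * d) ∸ (t % d + t / d * d)  ≡⟨ cong (λ r → (r + n / d * d) ∸ (t % d + t / d * d)) n≡t ⟩
    (t % d + n / d * d) ∸ (t % d + t / d * d)  ≡⟨ [m+n]∸[m+o]≡n∸o (t % d) (n / d * d) (t / d * d) ⟩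
    n / d * d ∸ t / d * d                      ≡⟨ *-distribʳ-∸ d (n / d) (t / d) ⟨
    (n / d ∸ t / d) * d                        ∎

<-by-residue : ∀ {m n} d .{{_ : NonZero d}} → m ≤ n → m % d ≢ n % d → m < n
<-by-residue d m≤n m≢n = ≤∧≢⇒< m≤n (λ m≡n → m≢n (cong (_% d) m≡n))

count : ℕ → ℕ → ℕ → ℕ
count fuel k m = length (go fuel k m)

firstParts : ℕ → ℕ → List ℕ
firstParts k m = filter (k ≤?_) (map suc (upTo m))

filter-≤-map-suc : ∀ j l → filter (suc j ≤?_) (map suc l) ≡ map suc (filter (j ≤?_) l)
filter-≤-map-suc j [] = refl
filter-≤-map-suc j (x ∷ l) with j ≤? x
... | yes j≤x = begin
  filter (suc j ≤?_) (suc x ∷ map suc l)  ≡⟨ filter-accept (suc j ≤?_) (s≤s j≤x) ⟩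
  suc x ∷ filter (suc j ≤?_) (map suc l)  ≡⟨ cong (suc x ∷_) (filter-≤-map-suc j l) ⟩
  map suc (x ∷ filter (j ≤?_) l)          ≡⟨ cong (map suc) (filter-accept (j ≤?_) j≤x) ⟨
  map suc (filter (j ≤?_) (x ∷ l))        ∎
  where open ≡-Reasoning
... | no  j≰x = begin
  filter (suc j ≤?_) (suc x ∷ map suc l)  ≡⟨ filter-reject (suc j ≤?_) (λ j<x → j≰x (s≤s⁻¹ j<x)) ⟩
  filter (suc j ≤?_) (map suc l)          ≡⟨ filter-≤-map-suc j l ⟩
  map suc (filter (j ≤?_) l)              ≡⟨ cong (map suc) (filter-reject (j ≤?_) j≰x) ⟨
  map suc (filter (j ≤?_) (x ∷ l))        ∎
  where open ≡-Reasoning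

map-suc-upTo-suc : ∀ m → map suc (upTo (suc m)) ≡ 1 ∷ map suc (map suc (upTo m))
map-suc-upTo-suc m = cong (λ l → 1 ∷ map suc l) (sym (map-upTo suc m))

firstParts-1 : ∀ m → firstParts 1 m ≡ map suc (upTo m)
firstParts-1 m = filter-all (1 ≤?_) (All.map⁺ (All.universal (λ _ → s≤s z≤n) (upTo m)))

firstParts-suc : ∀ k m → firstParts (2 + k) (suc m) ≡ map suc (firstParts (suc k) m)
firstParts-suc k m = begin
  filter (2 + k ≤?_) (1 ∷ map suc (applyUpTo suc m))
    ≡⟨ filter-reject (2 + k ≤?_) {x = 1} {xs = map suc (applyUpTo suc m)} (λ { (s≤s ()) }) ⟩
  filter (2 + k ≤?_) (map suc (applyUpTo suc m))      ≡⟨ cong (λ l → filter (2 + k ≤?_) (map suc l)) (map-upTo suc m) ⟨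
  filter (2 + k ≤?_) (map suc (map suc (upTo m)))     ≡⟨ filter-≤-map-suc (suc k) (map suc (upTo m)) ⟩
  map suc (firstParts (suc k) m)                      ∎
  where open ≡-Reasoning

firstParts-≤ : ∀ {k m} → 1 ≤ k → k ≤ m → firstParts k m ≡ k ∷ firstParts (suc k) m
firstParts-≤ {1} {suc m} _ _ = begin
  firstParts 1 (suc m)           ≡⟨ firstParts-1 (suc m) ⟩
  map suc (upTo (suc m))         ≡⟨ map-suc-upTo-suc m ⟩
  1 ∷ map suc (map suc (upTo m)) ≡⟨ cong (λ l → 1 ∷ map suc l) (firstParts-1 m) ⟨
  1 ∷ map suc (firstParts 1 m)   ≡⟨ cong (1 ∷_) (firstParts-suc 0 m) ⟨
  1 ∷ firstParts 2 (suc m)       ∎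
  where open ≡-Reasoning
firstParts-≤ {suc (suc k)} {suc m} _ (s≤s k<m) = begin
  firstParts (2 + k) (suc m)                    ≡⟨ firstParts-suc k m ⟩
  map suc (firstParts (suc k) m)                ≡⟨ cong (map suc) (firstParts-≤ (s≤s z≤n) k<m) ⟩
  suc (suc k) ∷ map suc (firstParts (2 + k) m)  ≡⟨ cong (suc (suc k) ∷_) (firstParts-suc (suc k) m) ⟨
  suc (suc k) ∷ firstParts (3 + k) (suc m)      ∎
  where open ≡-Reasoning

firstParts-> : ∀ {k m} → m < k → firstParts k m ≡ []
firstParts-> {k} {zero} _ = refl
firstParts-> {suc (suc k)} {suc m} (s≤s m<k) =
  trans (firstParts-suc k m) (cong (map suc) (firstParts-> m<k))

length-concatMap-prefix : ∀ (xs : ℕ → List (List ℕ)) l →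
  length (concatMap (λ j → map (j ∷_) (xs j)) l) ≡ sum (map (λ j → length (xs j)) l)
length-concatMap-prefix xs [] = refl
length-concatMap-prefix xs (j ∷ l) =
  trans (length-++ (map (j ∷_) (xs j)))
        (cong₂ _+_ (length-map (j ∷_) (xs j)) (length-concatMap-prefix xs l))

count-sum : ∀ f k m → count (suc f) k (suc m) ≡ sum (map (λ j → count f j (suc m ∸ j)) (firstParts k (suc m)))
count-sum f k m = length-concatMap-prefix (λ j → go f j (suc m ∸ j)) (firstParts k (suc m))

count-split : ∀ {f k m} → 1 ≤ k → k ≤ suc m →
              count (suc f) k (suc m) ≡ count f k (suc m ∸ k) + count (suc f) (suc k) (suc m)
count-split {f} {k} {m} 1≤k k≤m =
  trans (count-sum f k m)
        (trans (cong (λ l → sum (map (λ j → count f j (suc m ∸ j)) l)) (firstParts-≤ 1≤k k≤m))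
               (cong (count f k (suc m ∸ k) +_) (sym (count-sum f (suc k) m))))

count-> : ∀ {f k m} → suc m < k → count (suc f) k (suc m) ≡ 0
count-> {f} {k} {m} m<k =
  trans (count-sum f k m) (cong (λ l → sum (map (λ j → count f j (suc m ∸ j)) l)) (firstParts-> m<k))

weighted-sum-bound : ∀ A B p q s t x y →
    5 * A * p + 4 * B * q ≤ 5 * A * q →
    1000 * q * s * x ≤ A * p * t →
    1000 * (5 * q) * (p * s) * y ≤ B * (4 * p) * (q * t) →
    1000 * q * (p * s) * (x + y) ≤ A * p * (q * t)
weighted-sum-bound A B p q s t x y weights x-bound y-bound = *-cancelˡ-≤ 5 (begin
  5 * (1000 * q * (p * s) * (x + y))
    ≡⟨ expand p q s x y ⟩
  5 * p * (1000 * q * s * x) + 1000 * (5 * q) * (p * s) * y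
    ≤⟨ +-mono-≤ (*-monoʳ-≤ (5 * p) x-bound) y-bound ⟩
  5 * p * (A * p * t) + B * (4 * p) * (q * t)
    ≡⟨ factor A B p q t ⟩
  (5 * A * p + 4 * B * q) * (p * t)
    ≤⟨ *-monoˡ-≤ (p * t) weights ⟩
  5 * A * q * (p * t)
    ≡⟨ regroup A p q t ⟩
  5 * (A * p * (q * t)) ∎)
  where
  open ≤-Reasoning
  expand : ∀ p q s x y → 5 * (1000 * q * (p * s) * (x + y)) ≡ 5 * p * (1000 * q * s * x) + 1000 * (5 * q) * (p * s) * y
  expand = solve-∀
  factor : ∀ A B p q t → 5 * p * (A * p * t) + B * (4 * p) * (q * t) ≡ (5 * A * p + 4 * B * q) * (p * t)
  factor = solve-∀
  regroup : ∀ A p q t → 5 * A * q * (p * t) ≡ 5 * (A * p * (q * t))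
  regroup = solve-∀

-- CountBound below says count f k m ≤ (weight k / 1000) (5/4)^(m − k). It survives count-split
-- because weight (k + 1) ≤ (5/4) (1 − (4/5)^k) weight k (weight-step): the weights are this
-- recursion run backwards from the constant 1000, which is self-sustaining once (4/5)^k ≤ 1/5.
weight : ℕ → ℕ
weight 1 = 25840
weight 2 = 6460
weight 3 = 2907
weight 4 = 1773
weight 5 = 1308
weight 6 = 1099
weight 7 = 1013
weight _ = 1000

1000≤weight : ∀ k → 1000 ≤ weight k
1000≤weight 0 = ≤-refl
1000≤weight 1 = ≤ᵇ⇒≤ _ _ tt
1000≤weight 2 = ≤ᵇ⇒≤ _ _ tt
1000≤weight 3 = ≤ᵇ⇒≤ _ _ tt
1000≤weight 4 = ≤ᵇ⇒≤ _ _ tt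
1000≤weight 5 = ≤ᵇ⇒≤ _ _ tt
1000≤weight 6 = ≤ᵇ⇒≤ _ _ tt
1000≤weight 7 = ≤ᵇ⇒≤ _ _ tt
1000≤weight (suc (suc (suc (suc (suc (suc (suc (suc k)))))))) = ≤-refl

5*4^[8+j]≤5^[8+j] : ∀ j → 5 * 4 ^ (8 + j) ≤ 5 ^ (8 + j)
5*4^[8+j]≤5^[8+j] zero = ≤ᵇ⇒≤ _ _ tt
5*4^[8+j]≤5^[8+j] (suc j) = begin
  5 * (4 * 4 ^ (8 + j))  ≡⟨ trans (sym (*-assoc 5 4 (4 ^ (8 + j)))) (*-assoc 4 5 (4 ^ (8 + j))) ⟩
  4 * (5 * 4 ^ (8 + j))  ≤⟨ *-mono-≤ (≤ᵇ⇒≤ 4 5 tt) (5*4^[8+j]≤5^[8+j] j) ⟩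
  5 * 5 ^ (8 + j)        ∎
  where open ≤-Reasoning

weight-step : ∀ k → 1 ≤ k → 5 * weight k * 4 ^ k + 4 * weight (suc k) * 5 ^ k ≤ 5 * weight k * 5 ^ k
weight-step 1 _ = ≤ᵇ⇒≤ _ _ tt
weight-step 2 _ = ≤ᵇ⇒≤ _ _ tt
weight-step 3 _ = ≤ᵇ⇒≤ _ _ tt
weight-step 4 _ = ≤ᵇ⇒≤ _ _ tt
weight-step 5 _ = ≤ᵇ⇒≤ _ _ tt
weight-step 6 _ = ≤ᵇ⇒≤ _ _ tt
weight-step 7 _ = ≤ᵇ⇒≤ _ _ tt
weight-step (suc (suc (suc (suc (suc (suc (suc (suc j)))))))) _ =
  large (4 ^ (8 + j)) (5 ^ (8 + j)) (5*4^[8+j]≤5^[8+j] j)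
  where
  large : ∀ x y → 5 * x ≤ y → 5 * 1000 * x + 4 * 1000 * y ≤ 5 * 1000 * y
  large x y 5x≤y = begin
    5 * 1000 * x + 4 * 1000 * y  ≡⟨ cong (_+ 4000 * y) (*-assoc 1000 5 x) ⟩
    1000 * (5 * x) + 4000 * y    ≤⟨ +-monoˡ-≤ (4000 * y) (*-monoʳ-≤ 1000 5x≤y) ⟩
    1000 * y + 4000 * y          ≡⟨ *-distribʳ-+ y 1000 4000 ⟨
    5 * 1000 * y                 ∎
    where open ≤-Reasoning

CountBound : ℕ → ℕ → ℕ → Set
CountBound f k m = 1000 * 5 ^ k * 4 ^ m * count f k m ≤ weight k * 4 ^ k * 5 ^ m

count≡0⇒CountBound : ∀ {f k m} → count f k m ≡ 0 → CountBound f k m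
count≡0⇒CountBound {f} {k} {m} c≡0 rewrite c≡0 | *-zeroʳ (1000 * 5 ^ k * 4 ^ m) = z≤n

count-diagonal : ∀ f k → count (suc f) (suc k) (suc k) ≡ 1
count-diagonal f k = begin
  count (suc f) (suc k) (suc k)
    ≡⟨ count-split {f} {suc k} {k} (s≤s z≤n) ≤-refl ⟩
  count f (suc k) (suc k ∸ suc k) + count (suc f) (2 + k) (suc k)
    ≡⟨ cong₂ _+_ (cong (count f (suc k)) (n∸n≡0 k)) (count-> {f} {2 + k} {k} ≤-refl) ⟩
  count f (suc k) 0 + 0
    ≡⟨ +-identityʳ _ ⟩
  count f (suc k) 0
    ≡⟨ count-zero f (suc k) ⟩
  1 ∎
  where
  open ≡-Reasoning
  count-zero : ∀ f k → count f k 0 ≡ 1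
  count-zero zero    k = refl
  count-zero (suc f) k = refl

count-bound : ∀ f k m → 1 ≤ k → CountBound f k (suc m)
count-bound zero k m _ = count≡0⇒CountBound {0} {k} {suc m} refl
count-bound (suc f) k m _ with k ≤? suc m
... | no  k≰m = count≡0⇒CountBound {suc f} {k} {suc m} (count-> (≰⇒> k≰m))
count-bound (suc f) (suc k) m _ | yes k≤m =
  subst (CountBound (suc f) (suc k)) (m+[n∸m]≡n k≤m) (fixed-size (suc m ∸ suc k) k)
  where
  fixed-size : ∀ r k → CountBound (suc f) (suc k) (suc k + r)
  fixed-size zero k =
    subst (CountBound (suc f) (suc k)) (sym (+-identityʳ (suc k)))
      (subst (λ c → 1000 * 5 ^ suc k * 4 ^ suc k * c ≤ weight (suc k) * 4 ^ suc k * 5 ^ suc k)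
             (sym (count-diagonal f k))
             (diagonal (5 ^ suc k) (4 ^ suc k) (1000≤weight (suc k))))
    where
    diagonal : ∀ {w} x y → 1000 ≤ w → 1000 * x * y * 1 ≤ w * y * x
    diagonal {w} x y 1000≤w = begin
      1000 * x * y * 1  ≡⟨ reorder x y ⟩
      1000 * (y * x)    ≤⟨ *-monoˡ-≤ (y * x) 1000≤w ⟩
      w * (y * x)       ≡⟨ *-assoc w y x ⟨
      w * y * x         ∎
      where
      open ≤-Reasoning
      reorder : ∀ x y → 1000 * x * y * 1 ≡ 1000 * (y * x)
      reorder = solve-∀
  fixed-size (suc r) k = begin
    1000 * q * 4 ^ (suc k + suc r) * count (suc f) (suc k) (suc k + suc r)
      ≡⟨ cong₂ (λ u c → 1000 * q * u * c) (^-distribˡ-+-* 4 (suc k) (suc r)) split ⟩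
    1000 * q * (p * s) * (x + y)
      ≤⟨ weighted-sum-bound (weight (suc k)) (weight (2 + k)) p q s t x y
           (weight-step (suc k) (s≤s z≤n)) (count-bound f (suc k) r (s≤s z≤n)) y-bound ⟩
    weight (suc k) * p * (q * t)
      ≡⟨ cong (weight (suc k) * p *_) (^-distribˡ-+-* 5 (suc k) (suc r)) ⟨
    weight (suc k) * p * 5 ^ (suc k + suc r) ∎
    where
    open ≤-Reasoning
    p = 4 ^ suc k
    q = 5 ^ suc k
    s = 4 ^ suc r
    t = 5 ^ suc r
    x = count f (suc k) (suc r)
    y = count (suc f) (2 + k) (suc k + suc r)
    split : count (suc f) (suc k) (suc k + suc r) ≡ x + y
    split = trans (count-split (s≤s z≤n) (s≤s (m≤m+n k (suc r))))
                  (cong (λ n → count f (suc k) n + y) (m+n∸m≡n k (suc r)))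
    y-bound : 1000 * (5 * q) * (p * s) * y ≤ weight (2 + k) * (4 * p) * (q * t)
    y-bound = subst₂ (λ u v → 1000 * (5 * q) * u * y ≤ weight (2 + k) * (4 * p) * v)
                     (^-distribˡ-+-* 4 (suc k) (suc r)) (^-distribˡ-+-* 5 (suc k) (suc r))
                     (subst (CountBound (suc f) (2 + k)) (sym (+-suc (suc k) r)) (fixed-size r (suc k)))

partitions-bound : ∀ m → 4 ^ m * length (partitions m) ≤ 21 * 5 ^ m
partitions-bound zero = ≤ᵇ⇒≤ _ _ tt
partitions-bound (suc m) = *-cancelˡ-≤ 5000 (begin
  5000 * (4 ^ suc m * length (partitions (suc m)))  ≡⟨ *-assoc 5000 (4 ^ suc m) _ ⟨
  1000 * 5 ^ 1 * 4 ^ suc m * count (suc m) 1 (suc m) ≤⟨ count-bound (suc m) 1 m ≤-refl ⟩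
  25840 * 4 ^ 1 * 5 ^ suc m                          ≤⟨ *-monoˡ-≤ (5 ^ suc m) (≤ᵇ⇒≤ 103360 105000 tt) ⟩
  5000 * 21 * 5 ^ suc m                              ≡⟨ *-assoc 5000 21 (5 ^ suc m) ⟩
  5000 * (21 * 5 ^ suc m)                            ∎)
  where open ≤-Reasoning

module Periodic {F : ℕ → ℕ} {d c n₀ : ℕ} (F-step : ∀ {n} → n₀ ≤ n → F (d + n) ≡ c * F n) where

  F-step-right : ∀ a {b} → n₀ ≤ a + b → F (a + (d + b)) ≡ c * F (a + b)
  F-step-right a {b} n₀≤a+b = begin
    F (a + (d + b))  ≡⟨ cong F (+-comm a (d + b)) ⟩
    F (d + b + a)    ≡⟨ cong F (+-assoc d b a) ⟩
    F (d + (b + a))  ≡⟨ cong (λ n → F (d + n)) (+-comm b a) ⟩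
    F (d + (a + b))  ≡⟨ F-step n₀≤a+b ⟩
    c * F (a + b)    ∎
    where open ≡-Reasoning

  F-closed-form : ∀ {r} q → n₀ ≤ r → F (r + q * d) ≡ c ^ q * F r
  F-closed-form {r} zero    _    = trans (cong F (+-identityʳ r)) (sym (*-identityˡ (F r)))
  F-closed-form {r} (suc q) n₀≤r = begin
    F (r + (d + q * d))    ≡⟨ F-step-right r (≤-trans n₀≤r (m≤m+n r (q * d))) ⟩
    c * F (r + q * d)      ≡⟨ cong (c *_) (F-closed-form q n₀≤r) ⟩
    c * (c ^ q * F r)      ≡⟨ *-assoc c (c ^ q) (F r) ⟨
    c * c ^ q * F r        ∎
    where open ≡-Reasoning

  F-scale-right : ∀ a {b} → n₀ ≤ b → F a * F (d + b) ≡ c * (F a * F b)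
  F-scale-right a {b} n₀≤b = trans (cong (F a *_) (F-step n₀≤b)) (x∙yz≈y∙xz (F a) c (F b))

  supermultiplicative : 0 < d → (∀ {a} → a < n₀ + d → ∀ {b} → b < n₀ + d → F a * F b ≤ F (a + b)) →
                        ∀ a b → F a * F b ≤ F (a + b)
  supermultiplicative d>0 window =
    stepwise-induction (λ a → ∀ b → F a * F b ≤ F (a + b)) d>0
      (λ a< → stepwise-induction (λ b → F _ * F b ≤ F (_ + b)) d>0 (window a<) (step-right _))
      step-left
    where
    step-right : ∀ a {b} → n₀ ≤ b → F a * F b ≤ F (a + b) → F a * F (d + b) ≤ F (a + (d + b))
    step-right a n₀≤b ab = subst₂ _≤_ (sym (F-scale-right a n₀≤b)) (sym (F-step-right a (≤-trans n₀≤b (m≤n+m _ a))))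
                                  (*-monoʳ-≤ c ab)
    step-left : ∀ {a} → n₀ ≤ a → (∀ b → F a * F b ≤ F (a + b)) → ∀ b → F (d + a) * F b ≤ F (d + a + b)
    step-left {a} n₀≤a ab b = begin
      F (d + a) * F b   ≡⟨ cong (_* F b) (F-step n₀≤a) ⟩
      c * F a * F b     ≡⟨ *-assoc c (F a) (F b) ⟩
      c * (F a * F b)   ≤⟨ *-monoʳ-≤ c (ab b) ⟩
      c * F (a + b)     ≡⟨ F-step (≤-trans n₀≤a (m≤m+n a b)) ⟨
      F (d + (a + b))   ≡⟨ cong F (+-assoc d a b) ⟨
      F (d + a + b)     ∎
      where open ≤-Reasoning

  strictly-supermultiplicative : ∀ {a b₀} → 0 < d → .{{NonZero c}} → b₀ ≤ n₀ →
    (∀ {b} → b < n₀ + d → b₀ ≤ b → F a * F b < F (a + b)) →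
    ∀ {b} → b₀ ≤ b → F a * F b < F (a + b)
  strictly-supermultiplicative {a} {b₀} d>0 b₀≤n₀ window {b} =
    stepwise-induction (λ b → b₀ ≤ b → F a * F b < F (a + b)) d>0 window step b
    where
    step : ∀ {b} → n₀ ≤ b → (b₀ ≤ b → F a * F b < F (a + b)) → b₀ ≤ d + b → F a * F (d + b) < F (a + (d + b))
    step n₀≤b ab _ = subst₂ _<_ (sym (F-scale-right a n₀≤b)) (sym (F-step-right a (≤-trans n₀≤b (m≤n+m _ a))))
                            (*-monoʳ-< c (ab (≤-trans b₀≤n₀ n₀≤b)))

  outgrows : ∀ {K u v m} → .{{NonZero u}} → 0 < d → n₀ ≤ m → u ^ d ≤ c * v ^ d →
             (∀ {n} → n < m + d → m ≤ n → K * u ^ n < v ^ n * F n) →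
             ∀ {n} → m ≤ n → K * u ^ n < v ^ n * F n
  outgrows {K} {u} {v} {m} d>0 n₀≤m u^d≤cv^d window {n} =
    stepwise-induction (λ n → m ≤ n → K * u ^ n < v ^ n * F n) d>0 window step n
    where
    step : ∀ {n} → m ≤ n → (m ≤ n → K * u ^ n < v ^ n * F n) → m ≤ d + n → K * u ^ (d + n) < v ^ (d + n) * F (d + n)
    step {n} m≤n IH _ = begin-strict
      K * u ^ (d + n)               ≡⟨ cong (K *_) (^-distribˡ-+-* u d n) ⟩
      K * (u ^ d * u ^ n)           ≡⟨ x∙yz≈y∙xz K (u ^ d) (u ^ n) ⟩
      u ^ d * (K * u ^ n)           <⟨ *-monoʳ-< (u ^ d) {{m^n≢0 u d}} (IH m≤n) ⟩
      u ^ d * (v ^ n * F n)         ≤⟨ *-monoˡ-≤ (v ^ n * F n) u^d≤cv^d ⟩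
      c * v ^ d * (v ^ n * F n)     ≡⟨ rearrange c (v ^ d) (v ^ n) (F n) ⟩
      v ^ d * v ^ n * (c * F n)     ≡⟨ cong₂ _*_ (^-distribˡ-+-* v d n) (F-step (≤-trans n₀≤m m≤n)) ⟨
      v ^ (d + n) * F (d + n)       ∎
      where
      open ≤-Reasoning
      rearrange : ∀ x y z w → x * y * (z * w) ≡ y * z * (x * w)
      rearrange = solve-∀

-- The paper's closed forms of max N(0,2;n) and max N(1,2;n), continued to small n by the maxima
-- there; this is what makes both functions supermultiplicative.
M₀ : ℕ → ℕ
M₀ 0 = 1
M₀ 1 = 1
M₀ 2 = 1
M₀ 3 = 3
M₀ 4 = 3
M₀ 5 = 5
M₀ 6 = 9
M₀ 7 = 11
M₀ (suc (suc (suc n@(suc (suc (suc (suc (suc _)))))))) = 3 * M₀ n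

M₁ : ℕ → ℕ
M₁ 0 = 1
M₁ 1 = 0
M₁ 2 = 2
M₁ 3 = 0
M₁ 4 = 4
M₁ 5 = 2
M₁ 6 = 8
M₁ 7 = 4
M₁ 8 = 16
M₁ 9 = 12
M₁ (suc (suc n@(suc (suc (suc (suc (suc (suc (suc (suc _)))))))))) = 2 * M₁ n

M₀-step : ∀ {n} → 5 ≤ n → M₀ (3 + n) ≡ 3 * M₀ n
M₀-step (s≤s (s≤s (s≤s (s≤s (s≤s _))))) = refl

M₁-step : ∀ {n} → 8 ≤ n → M₁ (2 + n) ≡ 2 * M₁ n
M₁-step (s≤s (s≤s (s≤s (s≤s (s≤s (s≤s (s≤s (s≤s _)))))))) = refl

module M₀-periodic = Periodic {M₀} {3} {3} {5} M₀-step
module M₁-periodic = Periodic {M₁} {2} {2} {8} M₁-step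

M₀-supermultiplicative : ∀ a b → M₀ a * M₀ b ≤ M₀ (a + b)
M₀-supermultiplicative = M₀-periodic.supermultiplicative (s≤s z≤n)
  (by-evaluation (allUpTo? (λ a → allUpTo? (λ b → M₀ a * M₀ b ≤? M₀ (a + b)) 8) 8) refl)

M₁-supermultiplicative : ∀ a b → M₁ a * M₁ b ≤ M₁ (a + b)
M₁-supermultiplicative = M₁-periodic.supermultiplicative (s≤s z≤n)
  (by-evaluation (allUpTo? (λ a → allUpTo? (λ b → M₁ a * M₁ b ≤? M₁ (a + b)) 10) 10) refl)

M₀-increasing : ∀ {b} → 4 ≤ b → M₀ 1 * M₀ b < M₀ (1 + b)
M₀-increasing = M₀-periodic.strictly-supermultiplicative {1} {4} (s≤s z≤n) (n≤1+n 4)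
  (by-evaluation (allUpTo? (λ b → 4 ≤? b →-dec M₀ 1 * M₀ b <? M₀ (1 + b)) 8) refl)

M₁-strict-at-5-or-7 : ∀ {a b} → a ≡ 5 ⊎ a ≡ 7 → 5 ≤ b → M₁ a * M₁ b < M₁ (a + b)
M₁-strict-at-5-or-7 {a} a≡5⊎7 = M₁-periodic.strictly-supermultiplicative {a} {5} (s≤s z≤n) (≤ᵇ⇒≤ 5 8 tt) (window a≡5⊎7)
  where
  window : ∀ {a} → a ≡ 5 ⊎ a ≡ 7 → ∀ {b} → b < 10 → 5 ≤ b → M₁ a * M₁ b < M₁ (a + b)
  window (inj₁ refl) = by-evaluation (allUpTo? (λ b → 5 ≤? b →-dec M₁ 5 * M₁ b <? M₁ (5 + b)) 10) refl
  window (inj₂ refl) = by-evaluation (allUpTo? (λ b → 5 ≤? b →-dec M₁ 7 * M₁ b <? M₁ (7 + b)) 10) refl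

M₀-outgrows-partitions : ∀ {n} → 31 ≤ n → 21 * 5 ^ n < 4 ^ n * M₀ n
M₀-outgrows-partitions = M₀-periodic.outgrows {21} {5} {4} {31} (s≤s z≤n) (≤ᵇ⇒≤ 5 31 tt) (≤ᵇ⇒≤ 125 192 tt)
  (by-evaluation (allUpTo? (λ n → 31 ≤? n →-dec 21 * 5 ^ n <? 4 ^ n * M₀ n) 34) refl)

M₁-outgrows-partitions : ∀ {n} → 31 ≤ n → 21 * 5 ^ n < 4 ^ n * M₁ n
M₁-outgrows-partitions = M₁-periodic.outgrows {21} {5} {4} {31} (s≤s z≤n) (≤ᵇ⇒≤ 8 31 tt) (≤ᵇ⇒≤ 25 32 tt)
  (by-evaluation (allUpTo? (λ n → 31 ≤? n →-dec 21 * 5 ^ n <? 4 ^ n * M₁ n) 33) refl)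

partitions<majorant : ∀ {M : ℕ → ℕ} → (∀ {n} → 31 ≤ n → 21 * 5 ^ n < 4 ^ n * M n) →
                      ∀ {n} → 31 ≤ n → length (partitions n) < M n
partitions<majorant {M} outgrows {n} 31≤n =
  *-cancelˡ-< (4 ^ n) _ _ (≤-<-trans (partitions-bound n) (outgrows 31≤n))

BelowOrTight : (ℕ → ℕ) → (ℕ → ℕ) → (ℕ → Set) → ℕ → Set
BelowOrTight φ F T m = φ m < F m ⊎ (φ m ≡ F m × T m)

data Tight₀ : ℕ → Set where
  at-0 : Tight₀ 0
  at-1 : Tight₀ 1
  at-3 : Tight₀ 3
  at-5 : Tight₀ 5
  at-7 : Tight₀ 7

tight₀? : Decidable Tight₀
tight₀? 0 = yes at-0
tight₀? 1 = yes at-1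
tight₀? 2 = no λ ()
tight₀? 3 = yes at-3
tight₀? 4 = no λ ()
tight₀? 5 = yes at-5
tight₀? 6 = no λ ()
tight₀? 7 = yes at-7
tight₀? (suc (suc (suc (suc (suc (suc (suc (suc _)))))))) = no λ ()

data Tight₁ : ℕ → Set where
  at-0 : Tight₁ 0
  at-1 : Tight₁ 1
  at-2 : Tight₁ 2
  at-3 : Tight₁ 3
  at-4 : Tight₁ 4
  at-5 : Tight₁ 5
  at-6 : Tight₁ 6
  at-7 : Tight₁ 7
  at-9 : Tight₁ 9

tight₁? : Decidable Tight₁
tight₁? 0 = yes at-0
tight₁? 1 = yes at-1
tight₁? 2 = yes at-2
tight₁? 3 = yes at-3
tight₁? 4 = yes at-4
tight₁? 5 = yes at-5
tight₁? 6 = yes at-6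
tight₁? 7 = yes at-7
tight₁? 8 = no λ ()
tight₁? 9 = yes at-9
tight₁? (suc (suc (suc (suc (suc (suc (suc (suc (suc (suc _)))))))))) = no λ ()

below-or-tight? : ∀ φ F {T} → Decidable T → Decidable (BelowOrTight φ F T)
below-or-tight? φ F T? m = φ m <? F m ⊎-dec (φ m ≟ F m ×-dec T? m)

below-or-tight : ∀ r {F T} → (∀ {m} → m < 31 → BelowOrTight (N r) F T m) →
                 (∀ {m} → 31 ≤ m → length (partitions m) < F m) → ∀ m → BelowOrTight (N r) F T m
below-or-tight r small large m with m <? 31
... | yes m<31 = small m<31
... | no  m≮31 = inj₁ (≤-<-trans (length-filter _ (partitions m)) (large (≮⇒≥ m≮31)))

N₀-below-or-tight : ∀ m → BelowOrTight (N 0) M₀ Tight₀ m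
N₀-below-or-tight = below-or-tight 0 (by-evaluation (allUpTo? (below-or-tight? (N 0) M₀ tight₀?) 31) refl)
                                     (partitions<majorant M₀-outgrows-partitions)

N₁-below-or-tight : ∀ m → BelowOrTight (N 1) M₁ Tight₁ m
N₁-below-or-tight = below-or-tight 1 (by-evaluation (allUpTo? (below-or-tight? (N 1) M₁ tight₁?) 31) refl)
                                     (partitions<majorant M₁-outgrows-partitions)

record TightCons (φ F : ℕ → ℕ) (T : ℕ → Set) (m : ℕ) (p : List ℕ) : Set where
  constructor tight-cons
  field
    head-tight  : T m
    head-pos    : 0 < F m
    tail-tight  : product (map φ p) ≡ F (sum p)
    tail-pos    : 0 < F (sum p)
    split-tight : F m * F (sum p) ≡ F (m + sum p)

module Majorant {φ F : ℕ → ℕ} {T : ℕ → Set}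
  (φ-below-or-tight : ∀ m → BelowOrTight φ F T m)
  (F-supermultiplicative : ∀ a b → F a * F b ≤ F (a + b))
  (F-empty : 1 ≤ F 0) where

  φ≤F : ∀ m → φ m ≤ F m
  φ≤F m with φ-below-or-tight m
  ... | inj₁ φ<F       = <⇒≤ φ<F
  ... | inj₂ (φ≡F , _) = ≤-reflexive φ≡F

  product-≤ : ∀ p → product (map φ p) ≤ F (sum p)
  product-≤ []      = F-empty
  product-≤ (m ∷ p) = ≤-trans (*-mono-≤ (φ≤F m) (product-≤ p)) (F-supermultiplicative m (sum p))

  cons-tight : ∀ m p → product (map φ (m ∷ p)) ≡ F (m + sum p) → 0 < F (m + sum p) → TightCons φ F T m p
  cons-tight m p tight pos with *-≤-tight (φ≤F m) (product-≤ p) (F-supermultiplicative m (sum p)) tight pos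
  ... | φ≡F , tail , split = tight-cons (head φ≡F) (pos-left split) tail (pos-right split) split
    where
    head : φ m ≡ F m → T m
    head φ≡F with φ-below-or-tight m
    ... | inj₁ φ<F     = contradiction φ≡F (<⇒≢ φ<F)
    ... | inj₂ (_ , t) = t
    pos-left : F m * F (sum p) ≡ F (m + sum p) → 0 < F m
    pos-left split = >-nonZero⁻¹ (F m) {{m*n≢0⇒m≢0 (F m) {{>-nonZero (subst (0 <_) (sym split) pos)}}}}
    pos-right : F m * F (sum p) ≡ F (m + sum p) → 0 < F (sum p)
    pos-right split = >-nonZero⁻¹ (F (sum p)) {{m*n≢0⇒n≢0 (F m) {{>-nonZero (subst (0 <_) (sym split) pos)}}}}

sum-replicate : ∀ k x → sum (replicate k x) ≡ k * x
sum-replicate zero    x = refl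
sum-replicate (suc k) x = cong (x +_) (sum-replicate k x)

sum-seed : ∀ k x t → sum (replicate k x ++ t) ≡ sum t + k * x
sum-seed k x t = trans (sum-++ (replicate k x) t) (trans (cong (_+ sum t) (sum-replicate k x)) (+-comm (k * x) (sum t)))

Nλ-replicate : ∀ r k x → Nλ r (replicate k x) ≡ N r x ^ k
Nλ-replicate r zero    x = refl
Nλ-replicate r (suc k) x = cong (N r x *_) (Nλ-replicate r k x)

Nλ-seed : ∀ r k x t → Nλ r (replicate k x ++ t) ≡ N r x ^ k * Nλ r t
Nλ-seed r k x t = begin
  product (map (N r) (replicate k x ++ t))                    ≡⟨ cong product (map-++ (N r) (replicate k x) t) ⟩
  product (map (N r) (replicate k x) ++ map (N r) t)          ≡⟨ product-++ (map (N r) (replicate k x)) (map (N r) t) ⟩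
  Nλ r (replicate k x) * Nλ r t                               ≡⟨ cong (_* Nλ r t) (Nλ-replicate r k x) ⟩
  N r x ^ k * Nλ r t                                          ∎
  where open ≡-Reasoning

data Seeded (d : ℕ) (Tail : List ℕ → Set) : List ℕ → Set where
  seeded : ∀ k {t} → Tail t → Seeded d Tail (replicate k d ++ t)

seeded-cons : ∀ {d Tail s} → Seeded d Tail s → Seeded d Tail (d ∷ s)
seeded-cons (seeded k t) = seeded (suc k) t

seed-residue : ∀ k d .{{_ : NonZero d}} t → sum (replicate k d ++ t) % d ≡ sum t % d
seed-residue k d t = trans (cong (_% d) (sum-seed k d t)) ([m+kn]%n≡m%n (sum t) k d)

seeded-sum-injective : ∀ {d Tail s s'} .{{_ : NonZero d}} →
  (∀ {t t'} → Tail t → Tail t' → sum t % d ≡ sum t' % d → t ≡ t') →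
  Seeded d Tail s → Seeded d Tail s' → sum s ≡ sum s' → s ≡ s'
seeded-sum-injective {d} tail-injective (seeded k {t} t-tail) (seeded k' {t'} t'-tail) sums
  with tail-injective t-tail t'-tail (trans (sym (seed-residue k d t)) (trans (cong (_% d) sums) (seed-residue k' d t')))
... | refl = cong (λ j → replicate j d ++ t)
                  (*-cancelʳ-≡ k k' d (+-cancelˡ-≡ (sum t) _ _ (trans (sym (sum-seed k d t)) (trans sums (sum-seed k' d t)))))

linked-seed : ∀ k {d t} → All (d ≤_) t → Linked _≤_ t → Linked _≤_ (replicate k d ++ t)
linked-seed zero                _           t-sorted = t-sorted
linked-seed (suc zero)          []          _        = [-]
linked-seed (suc zero)          (d≤x ∷ _)   t-sorted = d≤x ∷ t-sorted
linked-seed (suc (suc k))       t≥d         t-sorted = ≤-refl ∷ linked-seed (suc k) t≥d t-sorted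

seed-isPartition : ∀ k {d t} → 0 < d → All (d ≤_) t → Linked _≤_ t →
                   IsPartition (sum t + k * d) (replicate k d ++ t)
seed-isPartition k d>0 t≥d t-sorted =
  linked-seed k t≥d t-sorted ,
  All.++⁺ (All.replicate⁺ k d>0) (All.map (<-≤-trans d>0) t≥d) ,
  sum-seed k _ _

data Tail₀ : List ℕ → Set where
  none  : Tail₀ []
  five  : Tail₀ [ 5 ]
  seven : Tail₀ [ 7 ]

tail₀-residue-injective : ∀ {t t'} → Tail₀ t → Tail₀ t' → sum t % 3 ≡ sum t' % 3 → t ≡ t'
tail₀-residue-injective none  none  _ = refl
tail₀-residue-injective five  five  _ = refl
tail₀-residue-injective seven seven _ = refl
tail₀-residue-injective none  five  ()
tail₀-residue-injective none  seven ()
tail₀-residue-injective five  none  ()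
tail₀-residue-injective five  seven ()
tail₀-residue-injective seven none  ()
tail₀-residue-injective seven five  ()

Principal₀ : List ℕ → Set
Principal₀ = Seeded 3 Tail₀

module Majorant₀ = Majorant N₀-below-or-tight M₀-supermultiplicative ≤-refl

M₀-positive : ∀ n → 0 < M₀ n
M₀-positive 0 = s≤s z≤n
M₀-positive 1 = s≤s z≤n
M₀-positive 2 = s≤s z≤n
M₀-positive 3 = s≤s z≤n
M₀-positive 4 = s≤s z≤n
M₀-positive 5 = s≤s z≤n
M₀-positive 6 = s≤s z≤n
M₀-positive 7 = s≤s z≤n
M₀-positive (suc (suc (suc n@(suc (suc (suc (suc (suc _)))))))) = *-monoʳ-< 3 (M₀-positive n)


-- An absurd split-tight pattern is a failed numerical identity, e.g. M₀ 5 · M₀ 5 = 25 ≠ 33 = M₀ 10.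
extremal₀-step : ∀ {m rest} → TightCons (N 0) M₀ Tight₀ m rest → Principal₀ rest →
                 Linked _≤_ (m ∷ rest) → 2 ≤ m → Principal₀ (m ∷ rest)
extremal₀-step (tight-cons at-0 _ _ _ _ ) _                _        2≤0 = contradiction 2≤0 λ ()
extremal₀-step (tight-cons at-1 _ _ _ _ ) _                _        2≤1 = contradiction 2≤1 λ { (s≤s ()) }
extremal₀-step (tight-cons at-3 _ _ _ _ ) rest-principal   _        _   = seeded-cons rest-principal
extremal₀-step (tight-cons at-5 _ _ _ _ ) (seeded 0 none)  _        _   = seeded 0 five
extremal₀-step (tight-cons at-5 _ _ _ ()) (seeded 0 five)  _        _
extremal₀-step (tight-cons at-5 _ _ _ ()) (seeded 0 seven) _        _
extremal₀-step (tight-cons at-5 _ _ _ _ ) (seeded (suc _) _) (s≤s (s≤s (s≤s ())) ∷ _) _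
extremal₀-step (tight-cons at-7 _ _ _ _ ) (seeded 0 none)  _        _   = seeded 0 seven
extremal₀-step (tight-cons at-7 _ _ _ _ ) (seeded 0 five)  (s≤s (s≤s (s≤s (s≤s (s≤s ())))) ∷ _) _
extremal₀-step (tight-cons at-7 _ _ _ ()) (seeded 0 seven) _        _
extremal₀-step (tight-cons at-7 _ _ _ _ ) (seeded (suc _) _) (s≤s (s≤s (s≤s ())) ∷ _) _

extremal₀ : ∀ p → Linked _≤_ p → All (2 ≤_) p → Nλ 0 p ≡ M₀ (sum p) → Principal₀ p
extremal₀ []         _      _              _     = seeded 0 none
extremal₀ (m ∷ rest) sorted (2≤m ∷ rest≥2) tight =
  extremal₀-step m-rest (extremal₀ rest (Linked.tail sorted) rest≥2 (TightCons.tail-tight m-rest)) sorted 2≤m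
  where
  m-rest = Majorant₀.cons-tight m rest tight (M₀-positive (m + sum rest))

1∷-not-extremal₀ : ∀ rest → 4 ≤ sum rest → Nλ 0 (1 ∷ rest) < M₀ (1 + sum rest)
1∷-not-extremal₀ rest 4≤s = ≤-<-trans (*-monoʳ-≤ (N 0 1) (Majorant₀.product-≤ rest)) (M₀-increasing 4≤s)

principal-partition₀ : ∀ {n p} → IsPartition n p → 5 ≤ n → Nλ 0 p ≡ M₀ n → Principal₀ p
principal-partition₀ {p = []}               (_ , _ , refl)      ()  _
principal-partition₀ {p = 0 ∷ _}            (_ , () ∷ _ , _)    _   _
principal-partition₀ {p = 1 ∷ rest}         (_ , _ , refl)      5≤n tight =
  contradiction tight (<⇒≢ (1∷-not-extremal₀ rest (s≤s⁻¹ 5≤n)))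
principal-partition₀ {p = suc (suc m) ∷ rest} (sorted , _ , refl) _   tight =
  extremal₀ _ sorted (Linked⇒All ≤-trans (s≤s (s≤s z≤n)) sorted) tight

MaxN₀UniquelyAt : ℕ → ℕ → List ℕ → Set
MaxN₀UniquelyAt n v w = MaxNIs 0 n v × (∀ p → IsPartition n p → Nλ 0 p ≡ v → p ≡ w)

max₀-only-at : ∀ {n w} → 5 ≤ n → Principal₀ w → IsPartition n w → Nλ 0 w ≡ M₀ n → MaxN₀UniquelyAt n (M₀ n) w
max₀-only-at {n} {w} 5≤n w-principal w-partition w-max = ((w , w-partition , w-max) , bound) , unique
  where
  bound : ∀ p → IsPartition n p → Nλ 0 p ≤ M₀ n
  bound p (_ , _ , refl) = Majorant₀.product-≤ p
  unique : ∀ p → IsPartition n p → Nλ 0 p ≡ M₀ n → p ≡ w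
  unique p p-partition@(_ , _ , p-sum) p-max =
    seeded-sum-injective tail₀-residue-injective (principal-partition₀ p-partition 5≤n p-max) w-principal
                         (trans p-sum (sym (proj₂ (proj₂ w-partition))))

M₀-seed : ∀ {t} → Tail₀ t → ∀ q → M₀ (sum t + q * 3) ≡ 3 ^ q * Nλ 0 t
M₀-seed none  zero                = refl
M₀-seed none  (suc zero)          = refl
M₀-seed none  (suc (suc q))       = trans (M₀-periodic.F-closed-form q (≤ᵇ⇒≤ 5 6 tt)) (shift (3 ^ q))
  where
  shift : ∀ x → x * 9 ≡ 3 * (3 * x) * 1
  shift = solve-∀
M₀-seed five  q = M₀-periodic.F-closed-form q ≤-refl
M₀-seed seven q = M₀-periodic.F-closed-form q (≤ᵇ⇒≤ 5 7 tt)

tail₀-above-3 : ∀ {t} → Tail₀ t → All (3 ≤_) t × Linked _≤_ t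
tail₀-above-3 none  = [] , []
tail₀-above-3 five  = ≤ᵇ⇒≤ 3 5 tt ∷ [] , [-]
tail₀-above-3 seven = ≤ᵇ⇒≤ 3 7 tt ∷ [] , [-]

max₀-at-seed : ∀ {n t} q → Tail₀ t → 5 ≤ n → n ≡ sum t + q * 3 → MaxN₀UniquelyAt n (M₀ n) (replicate q 3 ++ t)
max₀-at-seed {t = t} q t-tail 5≤n refl =
  max₀-only-at 5≤n (seeded q t-tail)
    (seed-isPartition q (s≤s z≤n) (proj₁ (tail₀-above-3 t-tail)) (proj₂ (tail₀-above-3 t-tail)))
    (trans (Nλ-seed 0 q 3 t) (sym (M₀-seed t-tail q)))

step-cons : ∀ x {p q} → Step p q → Step (x ∷ p) (x ∷ q)
step-cons x (inj₁ (ρ , p↭ , q↭)) = inj₁ (x ∷ ρ , move (2 ∷ 2 ∷ []) p↭ , move [ 4 ] q↭)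
  where
  move : ∀ {p} ys → p ↭ ys ++ ρ → x ∷ p ↭ ys ++ x ∷ ρ
  move ys p↭ = ↭-trans (↭-prep x p↭) (shifts [ x ] ys)
step-cons x (inj₂ (ρ , p↭ , q↭)) = inj₂ (x ∷ ρ , move (2 ∷ 2 ∷ 2 ∷ []) p↭ , move [ 6 ] q↭)
  where
  move : ∀ {p} ys → p ↭ ys ++ ρ → x ∷ p ↭ ys ++ x ∷ ρ
  move ys p↭ = ↭-trans (↭-prep x p↭) (shifts [ x ] ys)

obtainable-cons : ∀ x {p q} → Obtainable p q → Obtainable (x ∷ p) (x ∷ q)
obtainable-cons x = gmap (x ∷_) (step-cons x)

obtainable-invariant : (f : List ℕ → ℕ) → (∀ {p q} → p ↭ q → f p ≡ f q) →
                       (∀ ρ → f (2 ∷ 2 ∷ ρ) ≡ f (4 ∷ ρ)) → (∀ ρ → f (2 ∷ 2 ∷ 2 ∷ ρ) ≡ f (6 ∷ ρ)) →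
                       ∀ {p q} → Obtainable p q → f p ≡ f q
obtainable-invariant f f-↭ f-4 f-6 = fold (λ p q → f p ≡ f q) (λ s → trans (step-invariant s)) refl
  where
  step-invariant : ∀ {p q} → Step p q → f p ≡ f q
  step-invariant (inj₁ (ρ , p↭ , q↭)) = trans (f-↭ p↭) (trans (f-4 ρ) (sym (f-↭ q↭)))
  step-invariant (inj₂ (ρ , p↭ , q↭)) = trans (f-↭ p↭) (trans (f-6 ρ) (sym (f-↭ q↭)))

obtainable-sum : ∀ {p q} → Obtainable p q → sum p ≡ sum q
obtainable-sum = obtainable-invariant sum sum-↭ (λ _ → refl) (λ _ → refl)

obtainable-Nλ₁ : ∀ {p q} → Obtainable p q → Nλ 1 p ≡ Nλ 1 q
obtainable-Nλ₁ = obtainable-invariant (Nλ 1) (λ p↭q → product-↭ (map⁺ (N 1) p↭q))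
                   (λ ρ → sym (*-assoc 2 2 (Nλ 1 ρ)))
                   (λ ρ → trans (cong (2 *_) (sym (*-assoc 2 2 (Nλ 1 ρ)))) (sym (*-assoc 2 4 (Nλ 1 ρ))))

data Tail₁ : List ℕ → Set where
  none : Tail₁ []
  nine : Tail₁ [ 9 ]

tail₁-residue-injective : ∀ {t t'} → Tail₁ t → Tail₁ t' → sum t % 2 ≡ sum t' % 2 → t ≡ t'
tail₁-residue-injective none none _ = refl
tail₁-residue-injective nine nine _ = refl
tail₁-residue-injective none nine ()
tail₁-residue-injective nine none ()

data Principal₁ : List ℕ → Set where
  []  : Principal₁ []
  [9] : Principal₁ [ 9 ]
  2∷_ : ∀ {p} → Principal₁ p → Principal₁ (2 ∷ p)
  4∷_ : ∀ {p} → Principal₁ p → Principal₁ (4 ∷ p)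
  6∷_ : ∀ {p} → Principal₁ p → Principal₁ (6 ∷ p)

data Extremal₁ : List ℕ → Set where
  principal : ∀ {p} → Principal₁ p → Extremal₁ p
  [5]       : Extremal₁ [ 5 ]
  [7]       : Extremal₁ [ 7 ]
  [2,5]     : Extremal₁ (2 ∷ 5 ∷ [])

module Majorant₁ = Majorant N₁-below-or-tight M₁-supermultiplicative ≤-refl

extremal₁-step : ∀ {m rest} → TightCons (N 1) M₁ Tight₁ m rest → Extremal₁ rest →
                 Linked _≤_ (m ∷ rest) → 0 < m → Extremal₁ (m ∷ rest)
extremal₁-step (tight-cons at-0 _  _ _ _ ) _               _ ()
extremal₁-step (tight-cons at-1 () _ _ _ ) _               _ _
extremal₁-step (tight-cons at-3 () _ _ _ ) _               _ _
extremal₁-step (tight-cons at-2 _  _ _ _ ) (principal q)   _ _ = principal (2∷ q)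
extremal₁-step (tight-cons at-2 _  _ _ _ ) [5]             _ _ = [2,5]
extremal₁-step (tight-cons at-2 _  _ _ ()) [7]             _ _
extremal₁-step (tight-cons at-2 _  _ _ ()) [2,5]           _ _
extremal₁-step (tight-cons at-4 _  _ _ _ ) (principal q)   _ _ = principal (4∷ q)
extremal₁-step (tight-cons at-4 _  _ _ ()) [5]             _ _
extremal₁-step (tight-cons at-4 _  _ _ ()) [7]             _ _
extremal₁-step (tight-cons at-4 _  _ _ _ ) [2,5]           (s≤s (s≤s ()) ∷ _) _
extremal₁-step (tight-cons at-6 _  _ _ _ ) (principal q)   _ _ = principal (6∷ q)
extremal₁-step (tight-cons at-6 _  _ _ ()) [5]             _ _
extremal₁-step (tight-cons at-6 _  _ _ ()) [7]             _ _
extremal₁-step (tight-cons at-6 _  _ _ _ ) [2,5]           (s≤s (s≤s ()) ∷ _) _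
extremal₁-step (tight-cons at-5 _  _ _ _ ) _               [-] _ = [5]
extremal₁-step (tight-cons at-5 _  _ _ split) _            (5≤y ∷ _) _ =
  contradiction split (<⇒≢ (M₁-strict-at-5-or-7 (inj₁ refl) (≤-trans 5≤y (m≤m+n _ _))))
extremal₁-step (tight-cons at-7 _  _ _ _ ) _               [-] _ = [7]
extremal₁-step (tight-cons at-7 _  _ _ split) _            (7≤y ∷ _) _ =
  contradiction split (<⇒≢ (M₁-strict-at-5-or-7 (inj₂ refl) (≤-trans (≤-trans (≤ᵇ⇒≤ 5 7 tt) 7≤y) (m≤m+n _ _))))
extremal₁-step (tight-cons at-9 _  _ _ _ ) (principal [])  _ _ = principal [9]
extremal₁-step (tight-cons at-9 _  _ _ ()) (principal [9]) _ _
extremal₁-step (tight-cons at-9 _  _ _ _ ) (principal (2∷ _)) (s≤s (s≤s ()) ∷ _) _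
extremal₁-step (tight-cons at-9 _  _ _ _ ) (principal (4∷ _)) (s≤s (s≤s (s≤s (s≤s ()))) ∷ _) _
extremal₁-step (tight-cons at-9 _  _ _ _ ) (principal (6∷ _)) (s≤s (s≤s (s≤s (s≤s (s≤s (s≤s ())))))  ∷ _) _
extremal₁-step (tight-cons at-9 _  _ _ _ ) [5]             (s≤s (s≤s (s≤s (s≤s (s≤s ())))) ∷ _) _
extremal₁-step (tight-cons at-9 _  _ _ _ ) [7]             (s≤s (s≤s (s≤s (s≤s (s≤s (s≤s (s≤s ()))))))  ∷ _) _
extremal₁-step (tight-cons at-9 _  _ _ _ ) [2,5]           (s≤s (s≤s ()) ∷ _) _

extremal₁ : ∀ p → Linked _≤_ p → All (0 <_) p → Nλ 1 p ≡ M₁ (sum p) → 0 < M₁ (sum p) → Extremal₁ p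
extremal₁ []         _      _              _     _   = principal []
extremal₁ (m ∷ rest) sorted (0<m ∷ rest>0) tight pos =
  extremal₁-step m-rest
    (extremal₁ rest (Linked.tail sorted) rest>0 (TightCons.tail-tight m-rest) (TightCons.tail-pos m-rest))
    sorted 0<m
  where
  m-rest = Majorant₁.cons-tight m rest tight pos

principal-partition₁ : ∀ {n p} → IsPartition n p → 8 ≤ n → Nλ 1 p ≡ M₁ n → 0 < M₁ n → Principal₁ p
principal-partition₁ (sorted , p>0 , refl) 8≤n tight pos with extremal₁ _ sorted p>0 tight pos
... | principal p-principal = p-principal
... | [5]   = contradiction 8≤n (<⇒≱ (≤ᵇ⇒≤ 6 8 tt))
... | [7]   = contradiction 8≤n (<⇒≱ (≤ᵇ⇒≤ 8 8 tt))
... | [2,5] = contradiction 8≤n (<⇒≱ (≤ᵇ⇒≤ 8 8 tt))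

Seed₁ : List ℕ → Set
Seed₁ = Seeded 2 Tail₁

principal₁-seed : ∀ {p} → Principal₁ p → Σ (List ℕ) λ s → Seed₁ s × Obtainable s p
principal₁-seed []        = _ , seeded 0 none , ε
principal₁-seed [9]       = _ , seeded 0 nine , ε
principal₁-seed (2∷ p) with principal₁-seed p
... | s , s-seed , s↝p = 2 ∷ s , seeded-cons s-seed , obtainable-cons 2 s↝p
principal₁-seed (4∷ p) with principal₁-seed p
... | s , s-seed , s↝p =
  2 ∷ 2 ∷ s , seeded-cons (seeded-cons s-seed) , inj₁ (s , ↭-refl , ↭-refl) ◅ obtainable-cons 4 s↝p
principal₁-seed (6∷ p) with principal₁-seed p
... | s , s-seed , s↝p =
  2 ∷ 2 ∷ 2 ∷ s , seeded-cons (seeded-cons (seeded-cons s-seed)) , inj₂ (s , ↭-refl , ↭-refl) ◅ obtainable-cons 6 s↝p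

MaxN₁ExactlyFrom : ℕ → ℕ → List ℕ → Set
MaxN₁ExactlyFrom n v w = MaxNIs 1 n v × (∀ p → IsPartition n p → (Nλ 1 p ≡ v ⇔ Obtainable w p))

max₁-exactly-from : ∀ {n w} → 8 ≤ n → Seed₁ w → IsPartition n w → Nλ 1 w ≡ M₁ n → 0 < M₁ n →
                    MaxN₁ExactlyFrom n (M₁ n) w
max₁-exactly-from {n} {w} 8≤n w-seed w-partition w-max pos = ((w , w-partition , w-max) , bound) , exact
  where
  bound : ∀ p → IsPartition n p → Nλ 1 p ≤ M₁ n
  bound p (_ , _ , refl) = Majorant₁.product-≤ p
  exact : ∀ p → IsPartition n p → (Nλ 1 p ≡ M₁ n ⇔ Obtainable w p)
  exact p p-partition = mk⇔ to (λ w↝p → trans (sym (obtainable-Nλ₁ w↝p)) w-max)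
    where
    to : Nλ 1 p ≡ M₁ n → Obtainable w p
    to p-max with principal₁-seed (principal-partition₁ p-partition 8≤n p-max pos)
    ... | s , s-seed , s↝p = subst (λ s → Obtainable s p) s≡w s↝p
      where
      s≡w = seeded-sum-injective tail₁-residue-injective s-seed w-seed
              (trans (obtainable-sum s↝p) (trans (proj₂ (proj₂ p-partition)) (sym (proj₂ (proj₂ w-partition)))))

M₁-seed : ∀ {t} → Tail₁ t → ∀ q → M₁ (sum t + q * 2) ≡ 2 ^ q * Nλ 1 t
M₁-seed none zero                            = refl
M₁-seed none (suc zero)                      = refl
M₁-seed none (suc (suc zero))                = refl
M₁-seed none (suc (suc (suc zero)))          = refl
M₁-seed none (suc (suc (suc (suc q))))       = trans (M₁-periodic.F-closed-form q ≤-refl) (shift (2 ^ q))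
  where
  shift : ∀ x → x * 16 ≡ 2 * (2 * (2 * (2 * x))) * 1
  shift = solve-∀
M₁-seed nine q = M₁-periodic.F-closed-form q (≤ᵇ⇒≤ 8 9 tt)

tail₁-above-2 : ∀ {t} → Tail₁ t → All (2 ≤_) t × Linked _≤_ t × 0 < Nλ 1 t
tail₁-above-2 none = [] , [] , s≤s z≤n
tail₁-above-2 nine = ≤ᵇ⇒≤ 2 9 tt ∷ [] , [-] , s≤s z≤n

max₁-at-seed : ∀ {n t} q → Tail₁ t → 8 ≤ n → n ≡ sum t + q * 2 → MaxN₁ExactlyFrom n (M₁ n) (replicate q 2 ++ t)
max₁-at-seed {t = t} q t-tail 8≤n refl with tail₁-above-2 t-tail
... | t≥2 , t-sorted , t-pos =
  max₁-exactly-from 8≤n (seeded q t-tail) (seed-isPartition q (s≤s z≤n) t≥2 t-sorted)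
    (trans (Nλ-seed 1 q 2 t) (sym (M₁-seed t-tail q)))
    (subst (0 <_) (sym (M₁-seed t-tail q)) (*-mono-≤ (m^n>0 2 q) t-pos))

max₀-mod-0 : ∀ n → 5 ≤ n → n % 3 ≡ 0 → MaxN₀UniquelyAt n (3 ^ (n / 3)) (replicate (n / 3) 3)
max₀-mod-0 n 5≤n n%3≡0 =
  subst₂ (MaxN₀UniquelyAt n) (trans (cong M₀ n≡) (trans (M₀-seed none (n / 3)) (*-identityʳ _))) (++-identityʳ _)
         (max₀-at-seed (n / 3) none 5≤n n≡)
  where n≡ = residue-decomposition 0 3 z≤n n%3≡0

max₀-mod-1 : ∀ n → 5 ≤ n → n % 3 ≡ 1 →
             MaxN₀UniquelyAt n (11 * 3 ^ ((n ∸ 7) / 3)) (replicate ((n ∸ 7) / 3) 3 ++ [ 7 ])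
max₀-mod-1 n 5≤n n%3≡1 =
  subst (λ v → MaxN₀UniquelyAt n v (replicate q 3 ++ [ 7 ]))
        (trans (cong M₀ n≡) (trans (M₀-seed seven q) (*-comm (3 ^ q) 11)))
        (max₀-at-seed q seven 5≤n n≡)
  where
  q = (n ∸ 7) / 3
  6≤n = <-by-residue 3 5≤n λ e → case trans e n%3≡1 of λ ()
  7≤n = <-by-residue 3 6≤n λ e → case trans e n%3≡1 of λ ()
  n≡ = residue-decomposition 7 3 7≤n n%3≡1

max₀-mod-2 : ∀ n → 5 ≤ n → n % 3 ≡ 2 →
             MaxN₀UniquelyAt n (5 * 3 ^ ((n ∸ 5) / 3)) (replicate ((n ∸ 5) / 3) 3 ++ [ 5 ])
max₀-mod-2 n 5≤n n%3≡2 =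
  subst (λ v → MaxN₀UniquelyAt n v (replicate q 3 ++ [ 5 ]))
        (trans (cong M₀ n≡) (trans (M₀-seed five q) (*-comm (3 ^ q) 5)))
        (max₀-at-seed q five 5≤n n≡)
  where
  q = (n ∸ 5) / 3
  n≡ = residue-decomposition 5 3 5≤n n%3≡2

max₁-even : ∀ n → 8 ≤ n → n % 2 ≡ 0 → MaxN₁ExactlyFrom n (2 ^ (n / 2)) (replicate (n / 2) 2)
max₁-even n 8≤n n%2≡0 =
  subst₂ (MaxN₁ExactlyFrom n) (trans (cong M₁ n≡) (trans (M₁-seed none (n / 2)) (*-identityʳ _))) (++-identityʳ _)
         (max₁-at-seed (n / 2) none 8≤n n≡)
  where n≡ = residue-decomposition 0 2 z≤n n%2≡0

max₁-odd : ∀ n → 8 ≤ n → n % 2 ≡ 1 →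
           MaxN₁ExactlyFrom n (12 * 2 ^ ((n ∸ 9) / 2)) (replicate ((n ∸ 9) / 2) 2 ++ [ 9 ])
max₁-odd n 8≤n n%2≡1 =
  subst (λ v → MaxN₁ExactlyFrom n v (replicate q 2 ++ [ 9 ]))
        (trans (cong M₁ n≡) (trans (M₁-seed nine q) (*-comm (2 ^ q) 12)))
        (max₁-at-seed q nine 8≤n n≡)
  where
  q = (n ∸ 9) / 2
  9≤n = <-by-residue 2 8≤n λ e → case trans e n%2≡1 of λ ()
  n≡ = residue-decomposition 9 2 9≤n n%2≡1

theorem1p5 :
    ((n : ℕ) → 5 ≤ n →
      (n % 3 ≡ 0 →
        MaxNIs 0 n (3 ^ (n / 3))
        × (∀ p → IsPartition n p → Nλ 0 p ≡ 3 ^ (n / 3) → p ≡ replicate (n / 3) 3))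
      × (n % 3 ≡ 1 →
        MaxNIs 0 n (11 * 3 ^ ((n ∸ 7) / 3))
        × (∀ p → IsPartition n p → Nλ 0 p ≡ 11 * 3 ^ ((n ∸ 7) / 3) → p ≡ replicate ((n ∸ 7) / 3) 3 ++ [ 7 ]))
      × (n % 3 ≡ 2 →
        MaxNIs 0 n (5 * 3 ^ ((n ∸ 5) / 3))
        × (∀ p → IsPartition n p → Nλ 0 p ≡ 5 * 3 ^ ((n ∸ 5) / 3) → p ≡ replicate ((n ∸ 5) / 3) 3 ++ [ 5 ])))
    ×
    ((n : ℕ) → 8 ≤ n →
      (n % 2 ≡ 0 →
        MaxNIs 1 n (2 ^ (n / 2))
        × (∀ p → IsPartition n p → (Nλ 1 p ≡ 2 ^ (n / 2) ⇔ Obtainable (replicate (n / 2) 2) p)))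
      × (n % 2 ≡ 1 →
        MaxNIs 1 n (12 * 2 ^ ((n ∸ 9) / 2))
        × (∀ p → IsPartition n p → (Nλ 1 p ≡ 12 * 2 ^ ((n ∸ 9) / 2) ⇔ Obtainable (replicate ((n ∸ 9) / 2) 2 ++ [ 9 ]) p))))
theorem1p5 =
  (λ n 5≤n → max₀-mod-0 n 5≤n , max₀-mod-1 n 5≤n , max₀-mod-2 n 5≤n) ,
  (λ n 8≤n → max₁-even n 8≤n , max₁-odd n 8≤n)
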